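{- $$F_{\{231,312\}}(x,q,z)=\frac{1-qz^2}{1-xz-2qz^2}.$$
   Context: For permutations $\pi=\pi_1\cdots\pi_n\in\mathfrak{S}_n$ and $\sigma\in\mathfrak{S}_m$, $\pi$ contains $\sigma$ if there are indices $i_1<\dots<i_m$ such that $\pi_{i_1}\cdots\pi_{i_m}$ is in the same relative order as $\sigma$; otherwise $\pi$ avoids $\sigma$. For a set $\Sigma$ of patterns, $\mathfrak{S}_n(\Sigma)$ is the set of permutations in $\mathfrak{S}_n$ avoiding every pattern in $\Sigma$. $\mathrm{fp}(\pi)=|\{i:\pi_i=i\}|$, $\mathrm{exc}(\pi)=|\{i:\pi_i>i\}|$, and $F_\Sigma(x,q,z)=\sum_{n\ge0}\sum_{\pi\in\mathfrak{S}_n(\Sigma)}x^{\mathrm{fp}(\pi)}q^{\mathrm{exc}(\pi)}z^n$. -}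

module Defs where

open import Data.Bool using (Bool; true; false; _∧_; _∨_; not; if_then_else_)
open import Data.Nat using (ℕ; zero; suc; _∸_; _≡ᵇ_; _<ᵇ_)
import Data.Nat as ℕ
open import Data.Integer using (ℤ; +_; -_; _+_; _*_)
open import Data.List using (List; []; _∷_; map; concatMap; _++_; filter; length; all; any; upTo)
open import Relation.Binary.PropositionalEquality using (_≡_)
open import Relation.Nullary.Decidable using (Dec; yes; no)
open import Data.Bool using (T)

-- Permutations of [n] in one-line notation, as lists of naturals in 1..n.

range1 : ℕ → List ℕ
range1 n = map suc (upTo n)

words : ℕ → ℕ → List (List ℕ)
words zero    n = [] ∷ []
words (suc k) n = concatMap (λ v → map (v ∷_) (words k n)) (range1 n)

-- a word of length n over {1..n} is a permutation iff every value 1..n occurs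
isPerm : ℕ → List ℕ → Bool
isPerm n w = all (λ v → any (λ u → u ≡ᵇ v) w) (range1 n)

perms : ℕ → List (List ℕ)
perms n = filter (λ w → T? (isPerm n w)) (words n n)
  where
  T? : (b : Bool) → Dec (T b)
  T? true  = yes _
  T? false = no (λ ())

subseqs : ℕ → List ℕ → List (List ℕ)
subseqs zero    _        = [] ∷ []
subseqs (suc m) []       = []
subseqs (suc m) (x ∷ xs) = map (x ∷_) (subseqs m xs) ++ subseqs (suc m) xs

-- the full table of comparisons [u_a < u_b] over all pairs (a , b);
-- for sequences of distinct entries this determines the relative order
relOrder : List ℕ → List Bool
relOrder u = concatMap (λ x → map (λ y → x <ᵇ y) u) u

eqBools : List Bool → List Bool → Bool
eqBools []       []       = true
eqBools (a ∷ as) (b ∷ bs) = (if a then b else not b) ∧ eqBools as bs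
eqBools _        _        = false

sameOrder : List ℕ → List ℕ → Bool
sameOrder u v = eqBools (relOrder u) (relOrder v)

contains : List ℕ → List ℕ → Bool
contains π σ = any (sameOrder σ) (subseqs (length σ) π)

avoidsAll : List (List ℕ) → List ℕ → Bool
avoidsAll Σ π = all (λ σ → not (contains π σ)) Σ

-- Statistics (positions are 1-based)

fpFrom : ℕ → List ℕ → ℕ
fpFrom k []       = 0
fpFrom k (x ∷ xs) = (if x ≡ᵇ k then 1 else 0) ℕ.+ fpFrom (suc k) xs

excFrom : ℕ → List ℕ → ℕ
excFrom k []       = 0
excFrom k (x ∷ xs) = (if k <ᵇ x then 1 else 0) ℕ.+ excFrom (suc k) xs

fp : List ℕ → ℕ
fp = fpFrom 1

exc : List ℕ → ℕ
exc = excFrom 1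

-- Formal power series in x, q, z with integer coefficients:
-- s i j n is the coefficient of x^i q^j z^n.

Series : Set
Series = ℕ → ℕ → ℕ → ℤ

sumTo : ℕ → (ℕ → ℤ) → ℤ
sumTo zero    f = f 0
sumTo (suc n) f = sumTo n f + f (suc n)

_⊛_ : Series → Series → Series
(f ⊛ g) i j n =
  sumTo i λ a → sumTo j λ b → sumTo n λ c →
    f a b c * g (i ∸ a) (j ∸ b) (n ∸ c)

bool : Bool → ℤ
bool true  = + 1
bool false = + 0

F : List (List ℕ) → Series
F Σ i j n =
  + length (filter (λ π → T? (avoidsAll Σ π ∧ (fp π ≡ᵇ i) ∧ (exc π ≡ᵇ j))) (perms n))
  where
  T? : (b : Bool) → Dec (T b)
  T? true  = yes _
  T? false = no (λ ())

numer : Series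
numer 0 0 0 = + 1
numer 0 1 2 = - (+ 1)
numer _ _ _ = + 0

denom : Series
denom 0 0 0 = + 1
denom 1 0 1 = - (+ 1)
denom 0 1 2 = - (+ 2)
denom _ _ _ = + 0

module Submission where

-- A permutation avoids 231 and 312 exactly when it is layered: a concatenation of decreasing runs of
-- consecutive values, each run lying above the previous ones.  (Below its first entry K an avoider must list
-- K - 1, K - 2, … in this order, since any other entry in between would create a 231 or a 312.)  Layered
-- permutations of [n] correspond to compositions of n, and a run of length m contributes m mod 2 fixed points
-- and ⌊m/2⌋ excedances.  Sorting compositions by their first part — 1, 2, or 2 more than the first part of a
-- nonempty composition of n - 2 — gives F = 1 + xzF + qz²F + qz²(F - 1), that is F · (1 - xz - 2qz²) = 1 - qz².

open import Defs
open import Data.List using (List; []; _∷_)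
open import Relation.Binary.PropositionalEquality
open import Data.Empty using (⊥-elim)
open import Data.List.Membership.Propositional using (_∈_; _∉_)
open import Data.List.Relation.Unary.Any using (here; there)
open import Data.Product using (∃; ∃₂; _×_; _,_; proj₁; proj₂)
open import Data.Sum using (_⊎_; inj₁; inj₂)
open import Relation.Nullary using (¬_; yes; no)
open import Data.List.Relation.Unary.Unique.Propositional using (Unique)

module ListFacts where

  open import Data.Bool using (Bool; true; false; T; if_then_else_)
  open import Data.Nat using (ℕ; suc; _+_; _≤_; _≟_; s≤s; z≤n)
  open import Data.Nat.Properties using (+-suc; ≤-antisym; ≤-trans; ≤-pred; <-irrefl; module ≤-Reasoning)
  open import Data.List using (List; []; _∷_; map; _++_; length; filter)
  open import Data.List.Properties using (length-++)
  open import Data.List.Membership.Propositional.Properties using (∈-++⁺ʳ; ∈-map⁻; ∈-∃++; ∈-filter⁺; ∈-filter⁻)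
  import Data.List.Relation.Unary.All as All
  open import Data.List.Relation.Unary.AllPairs using ([]; _∷_; tail)
  open import Data.List.Relation.Unary.Unique.Propositional.Properties as Unique using (Unique[x∷xs]⇒x∉xs)
  open import Data.List.Relation.Binary.Disjoint.Propositional using (Disjoint)
  open import Data.Unit using (tt)
  open import Function using (_∘_)
  open import Relation.Nullary using (¬?)
  open import Relation.Unary using (Decidable)

  count : ∀ {A : Set} → (A → Bool) → List A → ℕ
  count p []       = 0
  count p (x ∷ xs) = if p x then suc (count p xs) else count p xs

  count-++ : ∀ {A : Set} (p : A → Bool) xs ys → count p (xs ++ ys) ≡ count p xs + count p ys
  count-++ p []       ys = refl
  count-++ p (x ∷ xs) ys with p x
  ... | true  = cong suc (count-++ p xs ys)
  ... | false = count-++ p xs ys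

  count-map : ∀ {A B : Set} (p : B → Bool) (g : A → B) xs → count p (map g xs) ≡ count (λ x → p (g x)) xs
  count-map p g []       = refl
  count-map p g (x ∷ xs) with p (g x)
  ... | true  = cong suc (count-map p g xs)
  ... | false = count-map p g xs

  count-cong : ∀ {A : Set} {p q : A → Bool} xs → (∀ {x} → x ∈ xs → p x ≡ q x) → count p xs ≡ count q xs
  count-cong []       p≗q = refl
  count-cong (x ∷ xs) p≗q rewrite p≗q (here refl) = cong (λ n → if _ then suc n else n) (count-cong xs (p≗q ∘ there))

  count-false : ∀ {A : Set} (xs : List A) → count (λ _ → false) xs ≡ 0
  count-false []       = refl
  count-false (x ∷ xs) = count-false xs

  length-filter≡count : ∀ {A : Set} (p : A → Bool) (P? : Decidable (T ∘ p)) xs → length (filter P? xs) ≡ count p xs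
  length-filter≡count p P? []       = refl
  length-filter≡count p P? (x ∷ xs) with p x | P? x
  ... | true  | yes _  = cong suc (length-filter≡count p P? xs)
  ... | true  | no ¬px = ⊥-elim (¬px tt)
  ... | false | no _   = length-filter≡count p P? xs

  unique-++-disjoint : ∀ {A : Set} (xs : List A) {ys v} → Unique (xs ++ ys) → v ∈ xs → v ∉ ys
  unique-++-disjoint (x ∷ xs) (x∉ ∷ _)    (here refl) v∈ys = All.lookup x∉ (∈-++⁺ʳ xs v∈ys) refl
  unique-++-disjoint (x ∷ xs) (_  ∷ uniq) (there v∈)  v∈ys = unique-++-disjoint xs uniq v∈ v∈ys

  unique-map⁺ : ∀ {A B : Set} (f : A → B) {xs} → (∀ {x y} → x ∈ xs → y ∈ xs → f x ≡ f y → x ≡ y) →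
                Unique xs → Unique (map f xs)
  unique-map⁺ f {[]}     inj []           = []
  unique-map⁺ f {x ∷ xs} inj (x∉ ∷ uniq) =
    All.tabulate fresh ∷ unique-map⁺ f (λ x∈ y∈ → inj (there x∈) (there y∈)) uniq
    where
    fresh : ∀ {w} → w ∈ map f xs → f x ≢ w
    fresh w∈ with ∈-map⁻ f w∈
    ... | y , y∈ , refl = λ fx≡fy → All.lookup x∉ y∈ (inj (here refl) (there y∈) fx≡fy)

  disjoint-by : ∀ {A : Set} (P : A → Set) {xs ys : List A} →
                (∀ {v} → v ∈ xs → P v) → (∀ {v} → v ∈ ys → ¬ P v) → Disjoint xs ys
  disjoint-by P xs⇒P ys⇒¬P (v∈xs , v∈ys) = ys⇒¬P v∈ys (xs⇒P v∈xs)

  ∈-delete : ∀ {A : Set} (xs : List A) {v w ys} → v ∈ xs ++ w ∷ ys → v ≢ w → v ∈ xs ++ ys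
  ∈-delete []       (here refl) v≢w = ⊥-elim (v≢w refl)
  ∈-delete []       (there v∈)  v≢w = v∈
  ∈-delete (x ∷ xs) (here refl) v≢w = here refl
  ∈-delete (x ∷ xs) (there v∈)  v≢w = there (∈-delete xs v∈ v≢w)

  unique-length-≤ : ∀ {A : Set} {xs ys : List A} → Unique xs → (∀ {x} → x ∈ xs → x ∈ ys) → length xs ≤ length ys
  unique-length-≤ {xs = []}     _ _ = z≤n
  unique-length-≤ {xs = x ∷ xs} {ys} uniq xs⊆ys with ∈-∃++ (xs⊆ys (here refl))
  ... | as , bs , refl = begin
    suc (length xs)                ≤⟨ s≤s (unique-length-≤ (tail uniq) xs⊆as++bs) ⟩
    suc (length (as ++ bs))        ≡⟨ cong suc (length-++ as) ⟩
    suc (length as + length bs)    ≡⟨ sym (+-suc (length as) (length bs)) ⟩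
    length as + length (x ∷ bs)    ≡⟨ sym (length-++ as) ⟩
    length (as ++ x ∷ bs)          ∎
    where
    open ≤-Reasoning
    xs⊆as++bs : ∀ {y} → y ∈ xs → y ∈ as ++ bs
    xs⊆as++bs y∈ = ∈-delete as (xs⊆ys (there y∈)) (λ { refl → Unique[x∷xs]⇒x∉xs uniq y∈ })

  covering-unique : ∀ {ys zs : List ℕ} → Unique ys → (∀ {x} → x ∈ ys → x ∈ zs) → length zs ≤ length ys → Unique zs
  covering-unique {zs = []}     _    _     _   = []
  covering-unique {ys} {z ∷ zs} uniq cover len =
    All.tabulate z∉zs ∷ covering-unique (Unique.filter⁺ (λ y → ¬? (y ≟ z)) uniq) cover′ len′
    where
    ys′ = filter (λ y → ¬? (y ≟ z)) ys
    z∉zs : ∀ {w} → w ∈ zs → z ≢ w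
    z∉zs w∈ refl = <-irrefl refl (≤-trans len (unique-length-≤ uniq (λ y∈ → lower (cover y∈))))
      where
      lower : ∀ {y} → y ∈ z ∷ zs → y ∈ zs
      lower (here refl) = w∈
      lower (there y∈)  = y∈
    cover′ : ∀ {y} → y ∈ ys′ → y ∈ zs
    cover′ y∈ with ∈-filter⁻ (λ y → ¬? (y ≟ z)) y∈
    ... | y∈ys , y≢z with cover y∈ys
    ...   | here y≡z = ⊥-elim (y≢z y≡z)
    ...   | there y∈zs = y∈zs
    len′ : length zs ≤ length ys′
    len′ = ≤-pred (≤-trans len (unique-length-≤ uniq ys⊆z∷ys′))
      where
      ys⊆z∷ys′ : ∀ {y} → y ∈ ys → y ∈ z ∷ ys′
      ys⊆z∷ys′ {y} y∈ with y ≟ z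
      ... | yes refl = here refl
      ... | no  y≢z  = there (∈-filter⁺ (λ y → ¬? (y ≟ z)) y∈ y≢z)

  length-filter-unique : ∀ {A : Set} {P : A → Set} (P? : Decidable P) {xs ys} → Unique xs → Unique ys →
                         (∀ {z} → P z → z ∈ xs → z ∈ ys) → (∀ {z} → P z → z ∈ ys → z ∈ xs) →
                         length (filter P? xs) ≡ length (filter P? ys)
  length-filter-unique {P = P} P? uxs uys xs⊆ys ys⊆xs = ≤-antisym (included uxs xs⊆ys) (included uys ys⊆xs)
    where
    included : ∀ {xs ys} → Unique xs → (∀ {z} → P z → z ∈ xs → z ∈ ys) → length (filter P? xs) ≤ length (filter P? ys)
    included uniq sub = unique-length-≤ (Unique.filter⁺ P? uniq)
      (λ z∈ → let z∈xs , pz = ∈-filter⁻ P? z∈ in ∈-filter⁺ P? (sub pz z∈xs) pz)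

module PowerSeries where

  open import Data.Nat using (ℕ; zero; suc; _∸_)
  open import Data.Integer using (ℤ; +_; -_; _+_; _*_; -1ℤ)
  open import Data.Integer.Properties using (+-assoc; *-identityʳ; *-zeroʳ; +-identityˡ; +-identityʳ; *-distribʳ-+)
  open import Data.Integer.Tactic.RingSolver using (solve-∀)
  open import Function using (_∘_)

  δ : ℕ → ℕ → ℤ
  δ zero    zero    = + 1
  δ zero    (suc _) = + 0
  δ (suc k) zero    = + 0
  δ (suc k) (suc n) = δ k n

  -- shift k g is the coefficient sequence of z^k · g(z)
  shift : ℕ → (ℕ → ℤ) → ℕ → ℤ
  shift zero    g n       = g n
  shift (suc k) g zero    = + 0
  shift (suc k) g (suc n) = shift k g n

  monomial : ℕ → ℕ → ℕ → Series
  monomial a b c x y z = δ a x * (δ b y * δ c z)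

  sumTo-cong : ∀ n {g h : ℕ → ℤ} → (∀ k → g k ≡ h k) → sumTo n g ≡ sumTo n h
  sumTo-cong zero    g≗h = g≗h 0
  sumTo-cong (suc n) g≗h = cong₂ _+_ (sumTo-cong n g≗h) (g≗h (suc n))

  sumTo-suc : ∀ n (g : ℕ → ℤ) → sumTo (suc n) g ≡ g 0 + sumTo n (g ∘ suc)
  sumTo-suc zero    g = refl
  sumTo-suc (suc n) g = begin
    sumTo (suc n) g + g (suc (suc n))              ≡⟨ cong (_+ g (suc (suc n))) (sumTo-suc n g) ⟩
    g 0 + sumTo n (g ∘ suc) + g (suc (suc n))      ≡⟨ +-assoc (g 0) _ _ ⟩
    g 0 + sumTo (suc n) (g ∘ suc)                  ∎
    where open ≡-Reasoning

  sumTo-*ʳ : ∀ n (g : ℕ → ℤ) u → sumTo n (λ k → g k * u) ≡ sumTo n g * u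
  sumTo-*ʳ zero    g u = refl
  sumTo-*ʳ (suc n) g u = trans (cong (_+ g (suc n) * u) (sumTo-*ʳ n g u)) (sym (*-distribʳ-+ u (sumTo n g) _))

  sumTo-linear : ∀ n u (g h : ℕ → ℤ) → sumTo n (λ k → u * g k + h k) ≡ u * sumTo n g + sumTo n h
  sumTo-linear zero    u g h = refl
  sumTo-linear (suc n) u g h =
    trans (cong (_+ (u * g (suc n) + h (suc n))) (sumTo-linear n u g h))
          (regroup u (sumTo n g) (sumTo n h) (g (suc n)) (h (suc n)))
    where
    regroup : ∀ u s t a b → u * s + t + (u * a + b) ≡ u * (s + a) + (t + b)
    regroup = solve-∀

  shift-zero : ∀ k (g : ℕ → ℤ) → g 0 * δ k 0 ≡ shift k g 0
  shift-zero zero    g = *-identityʳ (g 0)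
  shift-zero (suc k) g = *-zeroʳ (g 0)

  shift-suc : ∀ k n (g : ℕ → ℤ) → g 0 * δ k (suc n) + shift k (g ∘ suc) n ≡ shift k g (suc n)
  shift-suc zero    n       g = trans (cong (_+ g (suc n)) (*-zeroʳ (g 0))) (+-identityˡ _)
  shift-suc (suc k) zero    g = trans (+-identityʳ _) (shift-zero k g)
  shift-suc (suc k) (suc n) g = shift-suc k n g

  sumTo-δ : ∀ n k (g : ℕ → ℤ) → sumTo n (λ c → g c * δ k (n ∸ c)) ≡ shift k g n
  sumTo-δ zero    k g = shift-zero k g
  sumTo-δ (suc n) k g = begin
    sumTo (suc n) (λ c → g c * δ k (suc n ∸ c))
      ≡⟨ sumTo-suc n _ ⟩
    g 0 * δ k (suc n) + sumTo n (λ c → g (suc c) * δ k (n ∸ c))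
      ≡⟨ cong (λ s → g 0 * δ k (suc n) + s) (sumTo-δ n k (g ∘ suc)) ⟩
    g 0 * δ k (suc n) + shift k (g ∘ suc) n
      ≡⟨ shift-suc k n g ⟩
    shift k g (suc n) ∎
    where open ≡-Reasoning

  ⊛-congˡ : ∀ {f g} h → (∀ i j n → f i j n ≡ g i j n) → ∀ i j n → (f ⊛ h) i j n ≡ (g ⊛ h) i j n
  ⊛-congˡ h f≡g i j n =
    sumTo-cong i (λ a → sumTo-cong j (λ b → sumTo-cong n (λ c → cong (_* h (i ∸ a) (j ∸ b) (n ∸ c)) (f≡g a b c))))

  ⊛-linearʳ : ∀ f {g h k} u → (∀ x y z → k x y z ≡ u * g x y z + h x y z) →
              ∀ i j n → (f ⊛ k) i j n ≡ u * (f ⊛ g) i j n + (f ⊛ h) i j n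
  ⊛-linearʳ f {g} {h} {k} u k≡ i j n = begin
    (f ⊛ k) i j n
      ≡⟨ sumTo-cong i (λ a → sumTo-cong j (λ b → sumTo-cong n (λ c →
           trans (cong (f a b c *_) (k≡ (i ∸ a) (j ∸ b) (n ∸ c))) (distrib (f a b c) u _ _)))) ⟩
    sumTo i (λ a → sumTo j (λ b → sumTo n (λ c →
      u * (f a b c * g (i ∸ a) (j ∸ b) (n ∸ c)) + f a b c * h (i ∸ a) (j ∸ b) (n ∸ c))))
      ≡⟨ sumTo-cong i (λ a → trans (sumTo-cong j (λ b → sumTo-linear n u _ _)) (sumTo-linear j u _ _)) ⟩
    sumTo i (λ a → u * sumTo j (λ b → sumTo n (λ c → f a b c * g (i ∸ a) (j ∸ b) (n ∸ c)))
                 + sumTo j (λ b → sumTo n (λ c → f a b c * h (i ∸ a) (j ∸ b) (n ∸ c))))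
      ≡⟨ sumTo-linear i u _ _ ⟩
    u * (f ⊛ g) i j n + (f ⊛ h) i j n ∎
    where
    open ≡-Reasoning
    distrib : ∀ p u q r → p * (u * q + r) ≡ u * (p * q) + p * r
    distrib = solve-∀

  ⊛-monomial : ∀ f a b c i j n →
               (f ⊛ monomial a b c) i j n ≡ shift a (λ i′ → shift b (λ j′ → shift c (f i′ j′) n) j) i
  ⊛-monomial f a b c i j n = begin
    (f ⊛ monomial a b c) i j n
      ≡⟨ sumTo-cong i (λ a′ → sumTo-cong j (λ b′ → sumTo-cong n (λ c′ → reorder (f a′ b′ c′) _ _ _))) ⟩
    sumTo i (λ a′ → sumTo j (λ b′ → sumTo n (λ c′ →
      f a′ b′ c′ * δ c (n ∸ c′) * δ b (j ∸ b′) * δ a (i ∸ a′))))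
      ≡⟨ sumTo-cong i (λ a′ → sumTo-cong j (λ b′ →
           trans (sumTo-*ʳ n _ _) (cong (_* δ a (i ∸ a′)) (trans (sumTo-*ʳ n _ _)
             (cong (_* δ b (j ∸ b′)) (sumTo-δ n c (f a′ b′))))))) ⟩
    sumTo i (λ a′ → sumTo j (λ b′ → shift c (f a′ b′) n * δ b (j ∸ b′) * δ a (i ∸ a′)))
      ≡⟨ sumTo-cong i (λ a′ → trans (sumTo-*ʳ j _ _) (cong (_* δ a (i ∸ a′)) (sumTo-δ j b _))) ⟩
    sumTo i (λ a′ → shift b (λ j′ → shift c (f a′ j′) n) j * δ a (i ∸ a′))
      ≡⟨ sumTo-δ i a _ ⟩
    shift a (λ i′ → shift b (λ j′ → shift c (f i′ j′) n) j) i ∎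
    where
    open ≡-Reasoning
    reorder : ∀ p x y z → p * (x * (y * z)) ≡ p * z * y * x
    reorder = solve-∀

  denom≡monomials : ∀ x y z →
    denom x y z ≡ -1ℤ * monomial 1 0 1 x y z + (- + 2 * monomial 0 1 2 x y z + monomial 0 0 0 x y z)
  denom≡monomials zero zero zero = refl
  denom≡monomials zero zero (suc z) = refl
  denom≡monomials zero (suc zero) zero = refl
  denom≡monomials zero (suc zero) (suc zero) = refl
  denom≡monomials zero (suc zero) (suc (suc zero)) = refl
  denom≡monomials zero (suc zero) (suc (suc (suc z))) = refl
  denom≡monomials zero (suc (suc y)) z = refl
  denom≡monomials (suc zero) zero zero = refl
  denom≡monomials (suc zero) zero (suc zero) = refl
  denom≡monomials (suc zero) zero (suc (suc z)) = refl
  denom≡monomials (suc zero) (suc y) z = refl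
  denom≡monomials (suc (suc x)) y z = refl

  ⊛-denom : ∀ f i j n → (f ⊛ denom) i j n ≡
    -1ℤ * shift 1 (λ i′ → shift 1 (f i′ j) n) i + (- + 2 * shift 1 (λ j′ → shift 2 (f i j′) n) j + f i j n)
  ⊛-denom f i j n = begin
    (f ⊛ denom) i j n
      ≡⟨ ⊛-linearʳ f {monomial 1 0 1} {rest} -1ℤ denom≡monomials i j n ⟩
    -1ℤ * (f ⊛ monomial 1 0 1) i j n + (f ⊛ rest) i j n
      ≡⟨ cong (λ s → -1ℤ * (f ⊛ monomial 1 0 1) i j n + s)
           (⊛-linearʳ f {monomial 0 1 2} {monomial 0 0 0} {rest} (- + 2) (λ _ _ _ → refl) i j n) ⟩
    -1ℤ * (f ⊛ monomial 1 0 1) i j n + (- + 2 * (f ⊛ monomial 0 1 2) i j n + (f ⊛ monomial 0 0 0) i j n)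
      ≡⟨ cong₂ (λ p q → -1ℤ * p + q) (⊛-monomial f 1 0 1 i j n)
           (cong₂ (λ p q → - + 2 * p + q) (⊛-monomial f 0 1 2 i j n) (⊛-monomial f 0 0 0 i j n)) ⟩
    -1ℤ * shift 1 (λ i′ → shift 1 (f i′ j) n) i + (- + 2 * shift 1 (λ j′ → shift 2 (f i j′) n) j + f i j n) ∎
    where
    open ≡-Reasoning
    rest : Series
    rest x y z = - + 2 * monomial 0 1 2 x y z + monomial 0 0 0 x y z

module Compositions where

  open ListFacts
  open import Data.Bool using (Bool; _∧_)
  open import Data.Nat using (ℕ; zero; suc; _+_; _<_; _≡ᵇ_; _%_; ⌊_/2⌋; s≤s; z≤n)
  open import Data.Nat.Properties using (<⇒≢; <-trans; n<1+n)
  open import Data.List using (List; []; _∷_; map; _++_; sum)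
  open import Data.List.Properties using (∷-injectiveʳ)
  open import Data.List.Membership.Propositional.Properties using (∈-++⁻; ∈-++⁺ˡ; ∈-++⁺ʳ; ∈-map⁺; ∈-map⁻)
  open import Data.List.Relation.Unary.All as All using (All; []; _∷_)
  import Data.List.Relation.Unary.All.Properties as All
  open import Data.List.Relation.Unary.AllPairs using ([]; _∷_)
  import Data.List.Relation.Unary.Unique.Propositional.Properties as Unique

  -- growHead [] is never applied to a composition; the value [2] makes it shift the statistics uniformly.
  growHead : List ℕ → List ℕ
  growHead []      = 2 ∷ []
  growHead (k ∷ c) = suc (suc k) ∷ c

  compositions  : ℕ → List (List ℕ)
  compositions⁺ : ℕ → List (List ℕ)

  compositions zero          = [] ∷ []
  compositions (suc zero)    = (1 ∷ []) ∷ []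
  compositions (suc (suc n)) =
    map (1 ∷_) (compositions (suc n)) ++ map (2 ∷_) (compositions n) ++ map growHead (compositions⁺ n)

  compositions⁺ zero    = []
  compositions⁺ (suc n) = compositions (suc n)

  compositionFp : List ℕ → ℕ
  compositionFp c = sum (map (_% 2) c)

  compositionExc : List ℕ → ℕ
  compositionExc c = sum (map ⌊_/2⌋ c)

  hasStats : ℕ → ℕ → List ℕ → Bool
  hasStats i j c = (compositionFp c ≡ᵇ i) ∧ (compositionExc c ≡ᵇ j)

  data IsComposition : ℕ → List ℕ → Set where
    []  : IsComposition 0 []
    _∷_ : ∀ {n c} m → IsComposition n c → IsComposition (suc m + n) (suc m ∷ c)

  ∷-∈-compositions : ∀ m {n c} → c ∈ compositions n → suc m ∷ c ∈ compositions (suc m + n)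
  ∷-∈-compositions zero          {zero}  (here refl) = here refl
  ∷-∈-compositions zero          {suc n} c∈          = ∈-++⁺ˡ (∈-map⁺ (1 ∷_) c∈)
  ∷-∈-compositions (suc zero)    {n}     c∈          =
    ∈-++⁺ʳ (map (1 ∷_) (compositions (suc n))) (∈-++⁺ˡ (∈-map⁺ (2 ∷_) c∈))
  ∷-∈-compositions (suc (suc m)) {n}     c∈          =
    ∈-++⁺ʳ (map (1 ∷_) (compositions (suc (suc (m + n)))))
      (∈-++⁺ʳ (map (2 ∷_) (compositions (suc (m + n)))) (∈-map⁺ growHead (∷-∈-compositions m c∈)))

  compositions-complete : ∀ {n c} → IsComposition n c → c ∈ compositions n
  compositions-complete []      = here refl
  compositions-complete (m ∷ p) = ∷-∈-compositions m (compositions-complete p)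

  growHead-composition : ∀ {n d} → IsComposition n d → IsComposition (suc (suc n)) (growHead d)
  growHead-composition []      = 1 ∷ []
  growHead-composition (m ∷ p) = suc (suc m) ∷ p

  compositions-sound  : ∀ n → All (IsComposition n) (compositions n)
  compositions⁺-sound : ∀ n → All (IsComposition n) (compositions⁺ n)

  compositions-sound zero          = [] ∷ []
  compositions-sound (suc zero)    = (0 ∷ []) ∷ []
  compositions-sound (suc (suc n)) =
    All.++⁺ (All.map⁺ (All.map (0 ∷_) (compositions-sound (suc n))))
      (All.++⁺ (All.map⁺ (All.map (1 ∷_) (compositions-sound n)))
        (All.map⁺ (All.map growHead-composition (compositions⁺-sound n))))

  compositions⁺-sound zero    = []
  compositions⁺-sound (suc n) = compositions-sound (suc n)

  compositions⁺-positive : ∀ n {d} → d ∈ compositions⁺ n → ∃₂ λ m c → d ≡ suc m ∷ c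
  compositions⁺-positive n d∈ with All.lookup (compositions⁺-sound n) d∈
  ... | m ∷ _ = m , _ , refl

  firstPart : List ℕ → ℕ
  firstPart []      = 0
  firstPart (k ∷ _) = k

  firstPart-∷ : ∀ k {xs c} → c ∈ map (k ∷_) xs → firstPart c ≡ k
  firstPart-∷ k c∈ with ∈-map⁻ (k ∷_) c∈
  ... | _ , _ , refl = refl

  firstPart-growHead : ∀ n {c} → c ∈ map growHead (compositions⁺ n) → 2 < firstPart c
  firstPart-growHead n c∈ with ∈-map⁻ growHead c∈
  ... | d , d∈ , refl with compositions⁺-positive n d∈
  ...   | m , _ , refl = s≤s (s≤s (s≤s z≤n))

  compositions-unique : ∀ n → Unique (compositions n)
  compositions-unique zero          = [] ∷ []
  compositions-unique (suc zero)    = [] ∷ []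
  compositions-unique (suc (suc n)) =
    Unique.++⁺ (Unique.map⁺ ∷-injectiveʳ (compositions-unique (suc n)))
      (Unique.++⁺ (Unique.map⁺ ∷-injectiveʳ (compositions-unique n)) (unique-map⁺ growHead growHead-inj (unique⁺ n))
        (disjoint-by (λ c → firstPart c ≡ 2) (firstPart-∷ 2) (λ c∈G eq → <⇒≢ (firstPart-growHead n c∈G) (sym eq))))
      (disjoint-by (λ c → firstPart c ≡ 1) (firstPart-∷ 1) not1)
    where
    unique⁺ : ∀ n → Unique (compositions⁺ n)
    unique⁺ zero    = []
    unique⁺ (suc n) = compositions-unique (suc n)
    growHead-inj : ∀ {x y} → x ∈ compositions⁺ n → y ∈ compositions⁺ n → growHead x ≡ growHead y → x ≡ y
    growHead-inj x∈ y∈ eq with compositions⁺-positive n x∈ | compositions⁺-positive n y∈ | eq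
    ... | _ , _ , refl | _ , _ , refl | refl = refl
    not1 : ∀ {c} → c ∈ map (2 ∷_) (compositions n) ++ map growHead (compositions⁺ n) → firstPart c ≢ 1
    not1 c∈ with ∈-++⁻ (map (2 ∷_) (compositions n)) c∈
    ... | inj₁ c∈B rewrite firstPart-∷ 2 c∈B = λ ()
    ... | inj₂ c∈G = λ eq → <⇒≢ (<-trans (n<1+n 1) (firstPart-growHead n c∈G)) (sym eq)

module CompositionSeries where

  open ListFacts
  open PowerSeries
  open Compositions
  open import Data.Bool using (false)
  open import Data.Bool.Properties using (∧-zeroʳ)
  open import Data.Nat using (ℕ; zero; suc)
  import Data.Nat as ℕ
  open import Data.Integer using (+_; -_; _+_; _*_; -1ℤ)
  open import Data.Integer.Properties using (pos-+; +-identityʳ)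
  open import Data.Integer.Tactic.RingSolver using (solve-∀)
  open import Data.List using (List; []; _∷_; map; _++_)

  compositionSeries : Series
  compositionSeries i j n = + count (hasStats i j) (compositions n)

  count-map-1∷ : ∀ i j cs → + count (hasStats i j) (map (1 ∷_) cs) ≡ shift 1 (λ i′ → + count (hasStats i′ j) cs) i
  count-map-1∷ zero    j cs = cong +_ (trans (count-map _ _ cs) (count-false cs))
  count-map-1∷ (suc i) j cs = cong +_ (count-map _ _ cs)

  count-map-exc-suc : ∀ (g : List ℕ → List ℕ) →
                      (∀ c → compositionFp (g c) ≡ compositionFp c) → (∀ c → compositionExc (g c) ≡ suc (compositionExc c)) →
                      ∀ i j cs → + count (hasStats i j) (map g cs) ≡ shift 1 (λ j′ → + count (hasStats i j′) cs) j
  count-map-exc-suc g fp≡ exc≡ i zero cs =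
    cong +_ (trans (count-map _ g cs) (trans (count-cong cs (λ {c} _ → rejected c)) (count-false cs)))
    where
    rejected : ∀ c → hasStats i 0 (g c) ≡ false
    rejected c rewrite exc≡ c = ∧-zeroʳ _
  count-map-exc-suc g fp≡ exc≡ i (suc j) cs = cong +_ (trans (count-map _ g cs) (count-cong cs (λ {c} _ → shifted c)))
    where
    shifted : ∀ c → hasStats i (suc j) (g c) ≡ hasStats i j c
    shifted c rewrite fp≡ c | exc≡ c = refl

  count-map-2∷ : ∀ i j cs → + count (hasStats i j) (map (2 ∷_) cs) ≡ shift 1 (λ j′ → + count (hasStats i j′) cs) j
  count-map-2∷ = count-map-exc-suc (2 ∷_) (λ _ → refl) (λ _ → refl)

  count-map-growHead : ∀ i j cs → + count (hasStats i j) (map growHead cs) ≡ shift 1 (λ j′ → + count (hasStats i j′) cs) j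
  count-map-growHead = count-map-exc-suc growHead fp≡ exc≡
    where
    fp≡ : ∀ c → compositionFp (growHead c) ≡ compositionFp c
    fp≡ []      = refl
    fp≡ (k ∷ c) = refl
    exc≡ : ∀ c → compositionExc (growHead c) ≡ suc (compositionExc c)
    exc≡ []      = refl
    exc≡ (k ∷ c) = refl

  numer-vanishes : ∀ i j n → numer i j (suc (suc (suc n))) ≡ + 0
  numer-vanishes zero zero n = refl
  numer-vanishes zero (suc zero) n = refl
  numer-vanishes zero (suc (suc j)) n = refl
  numer-vanishes (suc i) j n = refl

  -- compositions⁺ 0 lacks the empty composition: this is the term -qz² of the numerator.
  compositions⁺-correction : ∀ i j n →
    shift 1 (λ j′ → + count (hasStats i j′) (compositions⁺ n)) j ≡
    shift 1 (λ j′ → compositionSeries i j′ n) j + numer i j (suc (suc n))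
  compositions⁺-correction zero    zero             zero    = refl
  compositions⁺-correction zero    (suc zero)       zero    = refl
  compositions⁺-correction zero    (suc (suc j))    zero    = refl
  compositions⁺-correction (suc i) zero             zero    = refl
  compositions⁺-correction (suc i) (suc j)          zero    = refl
  compositions⁺-correction i       j                (suc n) =
    sym (trans (cong (λ t → shift 1 (λ j′ → compositionSeries i j′ (suc n)) j + t) (numer-vanishes i j n)) (+-identityʳ _))

  compositionSeries-recurrence : ∀ i j n → compositionSeries i j n ≡
    shift 1 (λ i′ → shift 1 (compositionSeries i′ j) n) i
      + (+ 2 * shift 1 (λ j′ → shift 2 (compositionSeries i j′) n) j + numer i j n)
  compositionSeries-recurrence zero zero zero = refl
  compositionSeries-recurrence zero (suc zero) zero = refl
  compositionSeries-recurrence zero (suc (suc j)) zero = refl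
  compositionSeries-recurrence (suc i) zero zero = refl
  compositionSeries-recurrence (suc i) (suc j) zero = refl
  compositionSeries-recurrence zero zero (suc zero) = refl
  compositionSeries-recurrence zero (suc zero) (suc zero) = refl
  compositionSeries-recurrence zero (suc (suc j)) (suc zero) = refl
  compositionSeries-recurrence (suc zero) zero (suc zero) = refl
  compositionSeries-recurrence (suc zero) (suc j) (suc zero) = refl
  compositionSeries-recurrence (suc (suc i)) zero (suc zero) = refl
  compositionSeries-recurrence (suc (suc i)) (suc j) (suc zero) = refl
  compositionSeries-recurrence i j (suc (suc n)) = begin
    + count P (map (1 ∷_) C₁ ++ map (2 ∷_) C₀ ++ map growHead C₀⁺)
      ≡⟨ cong +_ (trans (count-++ P (map (1 ∷_) C₁) _) (cong (a ℕ.+_) (count-++ P (map (2 ∷_) C₀) _))) ⟩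
    + (a ℕ.+ (b ℕ.+ c))
      ≡⟨ trans (pos-+ a (b ℕ.+ c)) (cong (λ t → + a + t) (pos-+ b c)) ⟩
    + a + (+ b + + c)
      ≡⟨ cong₂ _+_ (count-map-1∷ i j C₁) (cong₂ _+_ (count-map-2∷ i j C₀) (count-map-growHead i j C₀⁺)) ⟩
    S₁ + (S₂ + shift 1 (λ j′ → + count (hasStats i j′) C₀⁺) j)
      ≡⟨ cong (λ t → S₁ + (S₂ + t)) (compositions⁺-correction i j n) ⟩
    S₁ + (S₂ + (S₂ + numer i j (suc (suc n))))
      ≡⟨ double S₁ S₂ _ ⟩
    S₁ + (+ 2 * S₂ + numer i j (suc (suc n))) ∎
    where
    open ≡-Reasoning
    P = hasStats i j
    C₁ = compositions (suc n)
    C₀ = compositions n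
    C₀⁺ = compositions⁺ n
    a = count P (map (1 ∷_) C₁)
    b = count P (map (2 ∷_) C₀)
    c = count P (map growHead C₀⁺)
    S₁ = shift 1 (λ i′ → compositionSeries i′ j (suc n)) i
    S₂ = shift 1 (λ j′ → compositionSeries i j′ n) j
    double : ∀ a b c → a + (b + (b + c)) ≡ a + (+ 2 * b + c)
    double = solve-∀

  compositionSeries-⊛-denom : ∀ i j n → (compositionSeries ⊛ denom) i j n ≡ numer i j n
  compositionSeries-⊛-denom i j n = begin
    (compositionSeries ⊛ denom) i j n
      ≡⟨ ⊛-denom compositionSeries i j n ⟩
    -1ℤ * S₁ + (- + 2 * S₂ + compositionSeries i j n)
      ≡⟨ cong (λ t → -1ℤ * S₁ + (- + 2 * S₂ + t)) (compositionSeries-recurrence i j n) ⟩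
    -1ℤ * S₁ + (- + 2 * S₂ + (S₁ + (+ 2 * S₂ + numer i j n)))
      ≡⟨ cancel S₁ S₂ (numer i j n) ⟩
    numer i j n ∎
    where
    open ≡-Reasoning
    S₁ = shift 1 (λ i′ → shift 1 (compositionSeries i′ j) n) i
    S₂ = shift 1 (λ j′ → shift 2 (compositionSeries i j′) n) j
    cancel : ∀ a b c → -1ℤ * a + (- + 2 * b + (a + (+ 2 * b + c))) ≡ c
    cancel = solve-∀

module LayeredPermutations where

  open ListFacts
  open Compositions
  open import Data.Bool using (Bool; true; false; T; if_then_else_)
  open import Data.Bool.Properties using (T-≡)
  open import Data.Nat using (ℕ; zero; suc; _+_; _<_; _≤_; _≡ᵇ_; _<ᵇ_; _≟_; _≤?_; s≤s; z<s; _%_; ⌊_/2⌋)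
  open import Data.Nat.Properties
  open import Data.List using (List; []; _∷_; _++_; length)
  open import Data.List.Properties using (length-++; ++-cancelˡ; ∷-injectiveˡ)
  open import Data.List.Membership.Propositional.Properties using (∈-++⁻; ∈-++⁺ˡ; ∈-++⁺ʳ)
  import Data.List.Relation.Unary.All as All
  open import Data.List.Relation.Unary.AllPairs using ([]; _∷_)
  open import Data.List.Relation.Binary.Sublist.Propositional using (_⊆_; _∷_; _∷ʳ_; lookup; to∈)
  open import Data.Unit using (tt)
  open import Function using (Equivalence)

  block : ℕ → ℕ → List ℕ
  block a zero    = []
  block a (suc m) = suc (a + m) ∷ block a m

  layered : ℕ → List ℕ → List ℕ
  layered a []      = []
  layered a (m ∷ c) = block a m ++ layered (a + m) c

  record Arrangement (a n : ℕ) (π : List ℕ) : Set where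
    field
      length≡ : length π ≡ n
      bounded : ∀ {v} → v ∈ π → a < v × v ≤ a + n
      covers  : ∀ {v} → a < v → v ≤ a + n → v ∈ π

  length-block : ∀ a m → length (block a m) ≡ m
  length-block a zero    = refl
  length-block a (suc m) = cong suc (length-block a m)

  ∈-block⁻ : ∀ a m {v} → v ∈ block a m → a < v × v ≤ a + m
  ∈-block⁻ a (suc m) (here refl) = s≤s (m≤m+n a m) , ≤-reflexive (sym (+-suc a m))
  ∈-block⁻ a (suc m) (there v∈) =
    let a<v , v≤ = ∈-block⁻ a m v∈ in a<v , ≤-trans v≤ (+-monoʳ-≤ a (n≤1+n m))

  ∈-block⁺ : ∀ a m {v} → a < v → v ≤ a + m → v ∈ block a m
  ∈-block⁺ a zero    a<v v≤a+0 = ⊥-elim (<⇒≱ a<v (subst (_ ≤_) (+-identityʳ a) v≤a+0))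
  ∈-block⁺ a (suc m) {v} a<v v≤ with v ≟ suc (a + m)
  ... | yes refl = here refl
  ... | no  v≢   = there (∈-block⁺ a m a<v (≤-pred (≤∧≢⇒< (subst (v ≤_) (+-suc a m) v≤) v≢)))

  block-suc : ∀ a m → block a (suc m) ≡ block (suc a) m ++ suc a ∷ []
  block-suc a zero    = cong (_∷ []) (cong suc (+-identityʳ a))
  block-suc a (suc m) = cong₂ _∷_ (cong suc (+-suc a m)) (block-suc a m)

  block-unique : ∀ a m → Unique (block a m)
  block-unique a zero    = []
  block-unique a (suc m) = All.tabulate (λ v∈ eq → <-irrefl (sym eq) (s≤s (proj₂ (∈-block⁻ a m v∈)))) ∷ block-unique a m

  arrangement-unique : ∀ {a n π} → Arrangement a n π → Unique π
  arrangement-unique {a} {n} arr =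
    covering-unique (block-unique a n) (λ v∈ → let a<v , v≤ = ∈-block⁻ a n v∈ in covers a<v v≤)
                    (≤-reflexive (trans length≡ (sym (length-block a n))))
    where open Arrangement arr

  layered-arrangement : ∀ a {n c} → IsComposition n c → Arrangement a n (layered a c)
  layered-arrangement a [] = record
    { length≡ = refl
    ; bounded = λ ()
    ; covers  = λ a<v v≤a+0 → ⊥-elim (<⇒≱ a<v (subst (_ ≤_) (+-identityʳ a) v≤a+0))
    }
  layered-arrangement a {_} {suc m ∷ c} (_∷_ {n} m p) = record
    { length≡ = trans (length-++ (block a (suc m))) (cong₂ _+_ (length-block a (suc m)) Rest.length≡)
    ; bounded = bounded
    ; covers  = covers
    }
    where
    module Rest = Arrangement (layered-arrangement (a + suc m) p)
    assoc : a + suc m + n ≡ a + (suc m + n)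
    assoc = +-assoc a (suc m) n
    bounded : ∀ {v} → v ∈ layered a (suc m ∷ c) → a < v × v ≤ a + (suc m + n)
    bounded {v} v∈ with ∈-++⁻ (block a (suc m)) v∈
    ... | inj₁ v∈block = let a<v , v≤ = ∈-block⁻ a (suc m) v∈block in a<v , ≤-trans v≤ (+-monoʳ-≤ a (m≤m+n (suc m) n))
    ... | inj₂ v∈rest  = let a+m<v , v≤ = Rest.bounded v∈rest in ≤-<-trans (m≤m+n a (suc m)) a+m<v , subst (v ≤_) assoc v≤
    covers : ∀ {v} → a < v → v ≤ a + (suc m + n) → v ∈ layered a (suc m ∷ c)
    covers {v} a<v v≤ with v ≤? a + suc m
    ... | yes v≤a+m = ∈-++⁺ˡ (∈-block⁺ a (suc m) a<v v≤a+m)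
    ... | no  v≰a+m = ∈-++⁺ʳ (block a (suc m)) (Rest.covers (≰⇒> v≰a+m) (subst (v ≤_) (sym assoc) v≤))

  layered-injective : ∀ a {n n′ c c′} → IsComposition n c → IsComposition n′ c′ → layered a c ≡ layered a c′ → c ≡ c′
  layered-injective a []       []         _  = refl
  layered-injective a (m ∷ p) (m′ ∷ p′) eq with +-cancelˡ-≡ a m m′ (suc-injective (∷-injectiveˡ eq))
  ... | refl = cong (suc m ∷_) (layered-injective (a + suc m) p p′ (++-cancelˡ (block a (suc m)) _ _ eq))

  ≡ᵇ-true : ∀ {m n} → m ≡ n → (m ≡ᵇ n) ≡ true
  ≡ᵇ-true {m} {n} m≡n = Equivalence.to T-≡ (≡⇒≡ᵇ m n m≡n)

  ≡ᵇ-false : ∀ {m n} → m ≢ n → (m ≡ᵇ n) ≡ false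
  ≡ᵇ-false {m} {n} m≢n with m ≡ᵇ n in eq
  ... | true  = ⊥-elim (m≢n (≡ᵇ⇒≡ m n (subst T (sym eq) tt)))
  ... | false = refl

  <ᵇ-true : ∀ {m n} → m < n → (m <ᵇ n) ≡ true
  <ᵇ-true m<n = Equivalence.to T-≡ (<⇒<ᵇ m<n)

  <ᵇ-false : ∀ {m n} → n ≤ m → (m <ᵇ n) ≡ false
  <ᵇ-false {m} {n} n≤m with m <ᵇ n in eq
  ... | true  = ⊥-elim (<⇒≱ (<ᵇ⇒< m n (subst T (sym eq) tt)) n≤m)
  ... | false = refl

  indicator : Bool → ℕ
  indicator b = if b then 1 else 0

  positional-++ : ∀ (s : ℕ → List ℕ → ℕ) (t : ℕ → ℕ → ℕ) →
                  (∀ k → s k [] ≡ 0) → (∀ k x xs → s k (x ∷ xs) ≡ t k x + s (suc k) xs) →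
                  ∀ k xs ys → s k (xs ++ ys) ≡ s k xs + s (k + length xs) ys
  positional-++ s t s[] s∷ k []       ys = cong₂ _+_ (sym (s[] k)) (cong (λ k′ → s k′ ys) (sym (+-identityʳ k)))
  positional-++ s t s[] s∷ k (x ∷ xs) ys = begin
    s k (x ∷ xs ++ ys)                                      ≡⟨ s∷ k x (xs ++ ys) ⟩
    t k x + s (suc k) (xs ++ ys)                            ≡⟨ cong (t k x +_) (positional-++ s t s[] s∷ (suc k) xs ys) ⟩
    t k x + (s (suc k) xs + s (suc k + length xs) ys)       ≡⟨ sym (+-assoc (t k x) _ _) ⟩
    t k x + s (suc k) xs + s (suc (k + length xs)) ys       ≡⟨ cong₂ _+_ (sym (s∷ k x xs))
                                                                 (cong (λ k′ → s k′ ys) (sym (+-suc k (length xs)))) ⟩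
    s k (x ∷ xs) + s (k + length (x ∷ xs)) ys               ∎
    where open ≡-Reasoning

  fpFrom-++ : ∀ k xs ys → fpFrom k (xs ++ ys) ≡ fpFrom k xs + fpFrom (k + length xs) ys
  fpFrom-++ = positional-++ fpFrom (λ k x → indicator (x ≡ᵇ k)) (λ _ → refl) (λ _ _ _ → refl)

  excFrom-++ : ∀ k xs ys → excFrom k (xs ++ ys) ≡ excFrom k xs + excFrom (k + length xs) ys
  excFrom-++ = positional-++ excFrom (λ k x → indicator (k <ᵇ x)) (λ _ → refl) (λ _ _ _ → refl)

  -- The first entry of a block of length m + 2 is an excedance, its last entry is neither an excedance nor a
  -- fixed point, and in between sits a block of length m.
  block-fp : ∀ a m → fpFrom (suc a) (block a m) ≡ m % 2
  block-fp a zero          = refl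
  block-fp a (suc zero)    = cong (λ b → indicator b + 0) (≡ᵇ-true (+-identityʳ a))
  block-fp a (suc (suc m)) = begin
    indicator (a + suc m ≡ᵇ a) + fpFrom (suc (suc a)) (block a (suc m))
      ≡⟨ cong₂ (λ b xs → indicator b + fpFrom (suc (suc a)) xs) (≡ᵇ-false (>⇒≢ (m<m+n a z<s))) (block-suc a m) ⟩
    fpFrom (suc (suc a)) (block (suc a) m ++ suc a ∷ [])
      ≡⟨ fpFrom-++ (suc (suc a)) (block (suc a) m) (suc a ∷ []) ⟩
    fpFrom (suc (suc a)) (block (suc a) m) + (indicator (a ≡ᵇ suc (a + length (block (suc a) m))) + 0)
      ≡⟨ cong₂ (λ x b → x + (indicator b + 0)) (block-fp (suc a) m) (≡ᵇ-false (<⇒≢ (s≤s (m≤m+n a _)))) ⟩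
    m % 2 + 0
      ≡⟨ +-identityʳ _ ⟩
    m % 2 ∎
    where open ≡-Reasoning

  block-exc : ∀ a m → excFrom (suc a) (block a m) ≡ ⌊ m /2⌋
  block-exc a zero          = refl
  block-exc a (suc zero)    = cong (λ b → indicator b + 0) (<ᵇ-false (≤-reflexive (+-identityʳ a)))
  block-exc a (suc (suc m)) = begin
    indicator (a <ᵇ a + suc m) + excFrom (suc (suc a)) (block a (suc m))
      ≡⟨ cong₂ (λ b xs → indicator b + excFrom (suc (suc a)) xs) (<ᵇ-true (m<m+n a z<s)) (block-suc a m) ⟩
    suc (excFrom (suc (suc a)) (block (suc a) m ++ suc a ∷ []))
      ≡⟨ cong suc (excFrom-++ (suc (suc a)) (block (suc a) m) (suc a ∷ [])) ⟩
    suc (excFrom (suc (suc a)) (block (suc a) m) + (indicator (suc (a + length (block (suc a) m)) <ᵇ a) + 0))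
      ≡⟨ cong₂ (λ x b → suc (x + (indicator b + 0))) (block-exc (suc a) m) (<ᵇ-false (≤-trans (m≤m+n a _) (n≤1+n _))) ⟩
    suc (⌊ m /2⌋ + 0)
      ≡⟨ cong suc (+-identityʳ _) ⟩
    ⌊ suc (suc m) /2⌋ ∎
    where open ≡-Reasoning

  layered-fp : ∀ a c → fpFrom (suc a) (layered a c) ≡ compositionFp c
  layered-fp a []      = refl
  layered-fp a (m ∷ c) = begin
    fpFrom (suc a) (block a m ++ layered (a + m) c)
      ≡⟨ fpFrom-++ (suc a) (block a m) (layered (a + m) c) ⟩
    fpFrom (suc a) (block a m) + fpFrom (suc (a + length (block a m))) (layered (a + m) c)
      ≡⟨ cong₂ _+_ (block-fp a m) (cong (λ l → fpFrom (suc (a + l)) (layered (a + m) c)) (length-block a m)) ⟩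
    m % 2 + fpFrom (suc (a + m)) (layered (a + m) c)
      ≡⟨ cong (m % 2 +_) (layered-fp (a + m) c) ⟩
    compositionFp (m ∷ c) ∎
    where open ≡-Reasoning

  layered-exc : ∀ a c → excFrom (suc a) (layered a c) ≡ compositionExc c
  layered-exc a []      = refl
  layered-exc a (m ∷ c) = begin
    excFrom (suc a) (block a m ++ layered (a + m) c)
      ≡⟨ excFrom-++ (suc a) (block a m) (layered (a + m) c) ⟩
    excFrom (suc a) (block a m) + excFrom (suc (a + length (block a m))) (layered (a + m) c)
      ≡⟨ cong₂ _+_ (block-exc a m) (cong (λ l → excFrom (suc (a + l)) (layered (a + m) c)) (length-block a m)) ⟩
    ⌊ m /2⌋ + excFrom (suc (a + m)) (layered (a + m) c)
      ≡⟨ cong (⌊ m /2⌋ +_) (layered-exc (a + m) c) ⟩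
    compositionExc (m ∷ c) ∎
    where open ≡-Reasoning

  Forbidden : ℕ → ℕ → ℕ → Set
  Forbidden x y z = (z < x × x < y) ⊎ (y < z × z < x)

  Avoids : List ℕ → Set
  Avoids π = ∀ {x y z} → x ∷ y ∷ z ∷ [] ⊆ π → ¬ Forbidden x y z

  forbidden⇒last<first : ∀ {x y z} → Forbidden x y z → z < x
  forbidden⇒last<first (inj₁ (z<x , _)) = z<x
  forbidden⇒last<first (inj₂ (_ , z<x)) = z<x

  avoids-∷ : ∀ {w ws} → Avoids ws → (∀ {y z} → y ∷ z ∷ [] ⊆ ws → ¬ Forbidden w y z) → Avoids (w ∷ ws)
  avoids-∷ avoids harmless (_ ∷ʳ s)   = avoids s
  avoids-∷ avoids harmless (refl ∷ s) = harmless s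

  pair-in-block++ : ∀ a m {rest y z} → y ∷ z ∷ [] ⊆ block a m ++ rest → z ∈ rest ⊎ (z < y × y ≤ a + m)
  pair-in-block++ a zero    s = inj₁ (lookup s (there (here refl)))
  pair-in-block++ a (suc m) (_ ∷ʳ s) with pair-in-block++ a m s
  ... | inj₁ z∈rest         = inj₁ z∈rest
  ... | inj₂ (z<y , y≤a+m) = inj₂ (z<y , ≤-trans y≤a+m (+-monoʳ-≤ a (n≤1+n m)))
  pair-in-block++ a (suc m) (refl ∷ s) with ∈-++⁻ (block a m) (to∈ s)
  ... | inj₁ z∈block = inj₂ (s≤s (proj₂ (∈-block⁻ a m z∈block)) , ≤-reflexive (sym (+-suc a m)))
  ... | inj₂ z∈rest  = inj₁ z∈rest

  block-++-avoids : ∀ a m {rest} → Avoids rest → (∀ {u} → u ∈ rest → a + m < u) → Avoids (block a m ++ rest)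
  block-++-avoids a zero    avoids rest> = avoids
  block-++-avoids a (suc m) avoids rest> =
    avoids-∷ (block-++-avoids a m avoids (λ u∈ → ≤-<-trans (+-monoʳ-≤ a (n≤1+n m)) (rest> u∈))) harmless
    where
    harmless : ∀ {y z} → y ∷ z ∷ [] ⊆ block a m ++ _ → ¬ Forbidden (suc (a + m)) y z
    harmless {y} {z} s forbidden with pair-in-block++ a m s | forbidden
    ... | inj₁ z∈rest          | _                  =
      <-asym (forbidden⇒last<first forbidden) (subst (_< z) (+-suc a m) (rest> z∈rest))
    ... | inj₂ (z<y , y≤a+m)  | inj₁ (_ , w<y)     = <⇒≱ w<y (≤-trans y≤a+m (n≤1+n _))
    ... | inj₂ (z<y , _)      | inj₂ (y<z , _)     = <-asym z<y y<z

  layered-avoids : ∀ a {n c} → IsComposition n c → Avoids (layered a c)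
  layered-avoids a []       ()
  layered-avoids a (m ∷ p) = block-++-avoids a (suc m) (layered-avoids (a + suc m) p)
    (λ u∈ → proj₁ (Arrangement.bounded (layered-arrangement (a + suc m) p) u∈))

module AvoidersAreLayered where

  open ListFacts
  open Compositions
  open LayeredPermutations
  open import Data.Nat using (ℕ; zero; suc; _+_; _<_; _≤_; _≟_; _≤?_; s≤s)
  open import Data.Nat.Properties
  open import Data.Nat.Induction using (<-rec)
  open import Data.List using ([]; _∷_; _++_; length)
  open import Data.List.Properties using (length-++; ++-assoc)
  open import Data.List.Membership.Propositional.Properties using (∈-++⁻; ∈-++⁺ʳ)
  open import Data.List.Relation.Unary.AllPairs using (tail)
  open import Data.List.Relation.Unary.Unique.Propositional.Properties using (Unique[x∷xs]⇒x∉xs)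
  open import Data.List.Relation.Binary.Sublist.Propositional using (_⊆_; _∷_; _∷ʳ_; from∈)
  open import Data.List.Relation.Binary.Sublist.Propositional.Properties using (++⁺ˡ)

  avoider-sandwich : ∀ {K w y u} → Avoids (K ∷ w) → y ∷ u ∷ [] ⊆ w → u < K → u ≤ y × y ≤ K
  avoider-sandwich avoids s u<K =
    ≮⇒≥ (λ y<u → avoids (refl ∷ s) (inj₂ (y<u , u<K))) , ≮⇒≥ (λ K<y → avoids (refl ∷ s) (inj₁ (u<K , K<y)))

  -- If s began with some y ≠ c, then K y c would be a 231 (y > K) or a 312 (y < c), and otherwise
  -- c < y < K would put y into block c e a second time.
  block-next : ∀ {K c e s t} → Unique (K ∷ t) → Avoids (K ∷ t) → K ≡ suc (c + e) → t ≡ block c e ++ s → c ∈ t →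
               ∃ λ s′ → s ≡ c ∷ s′
  block-next {c = c} {e} uniq avoids refl refl c∈t with ∈-++⁻ (block c e) c∈t
  ... | inj₁ c∈block       = ⊥-elim (<-irrefl refl (proj₁ (∈-block⁻ c e c∈block)))
  ... | inj₂ (here refl)   = _ , refl
  block-next {c = c} {e} {y ∷ s″} uniq avoids refl refl c∈t | inj₂ (there c∈s″) with y ≟ c
  ... | yes refl = s″ , refl
  ... | no  y≢c  = ⊥-elim (unique-++-disjoint (block c e) (tail uniq) y∈block (here refl))
    where
    sandwich : c ≤ y × y ≤ suc (c + e)
    sandwich = avoider-sandwich avoids (++⁺ˡ (block c e) (refl ∷ from∈ c∈s″)) (s≤s (m≤m+n c e))
    y≢K : y ≢ suc (c + e)
    y≢K refl = Unique[x∷xs]⇒x∉xs uniq (∈-++⁺ʳ (block c e) (here refl))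
    y∈block : y ∈ block c e
    y∈block = ∈-block⁺ c e (≤∧≢⇒< (proj₁ sandwich) (λ c≡y → y≢c (sym c≡y))) (≤-pred (≤∧≢⇒< (proj₂ sandwich) y≢K))

  avoider-begins-with-block : ∀ {a m t} → Unique (suc (a + m) ∷ t) → Avoids (suc (a + m) ∷ t) →
                              (∀ {v} → a < v → v ≤ a + m → v ∈ t) → ∃ λ s → t ≡ block a m ++ s
  avoider-begins-with-block {a} {m} {t} uniq avoids covers = peel m a refl ≤-refl
    where
    peel : ∀ e b → b + e ≡ a + m → a ≤ b → ∃ λ s → t ≡ block b e ++ s
    peel zero    b _  _   = t , refl
    peel (suc e) b eq a≤b with peel e (suc b) (trans (sym (+-suc b e)) eq) (≤-trans a≤b (n≤1+n b))
    ... | s , t≡ with block-next uniq avoids (cong suc (trans (sym eq) (+-suc b e))) t≡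
                       (covers (s≤s a≤b) (subst (suc b ≤_) (trans (sym (+-suc b e)) eq) (s≤s (m≤m+n b e))))
    ...   | s′ , refl = s′ , (begin
      t                                        ≡⟨ t≡ ⟩
      block (suc b) e ++ suc b ∷ s′            ≡⟨ sym (++-assoc (block (suc b) e) (suc b ∷ []) s′) ⟩
      (block (suc b) e ++ suc b ∷ []) ++ s′    ≡⟨ cong (_++ s′) (sym (block-suc b e)) ⟩
      block b (suc e) ++ s′                    ∎)
      where open ≡-Reasoning

  first-entry-covers : ∀ {a n m t} → Arrangement a n (suc (a + m) ∷ t) → ∀ {v} → a < v → v ≤ a + m → v ∈ t
  first-entry-covers arr {v} a<v v≤a+m
    with Arrangement.covers arr a<v (≤-trans (n≤1+n v) (≤-trans (s≤s v≤a+m) (proj₂ (Arrangement.bounded arr (here refl)))))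
  ... | here refl = ⊥-elim (<-irrefl refl (s≤s v≤a+m))
  ... | there v∈t = v∈t

  arrangement-after-block : ∀ {a n m s} → Arrangement a n (suc (a + m) ∷ block a m ++ s) →
                            n ≡ suc m + length s × Arrangement (a + suc m) (length s) s
  arrangement-after-block {a} {n} {m} {s} arr = n≡ , record
    { length≡ = refl
    ; bounded = bounded′
    ; covers  = covers′
    }
    where
    open Arrangement arr
    uniq = arrangement-unique arr
    K≡ : a + suc m ≡ suc (a + m)
    K≡ = +-suc a m
    n≡ : n ≡ suc m + length s
    n≡ = trans (sym length≡) (cong suc (trans (length-++ (block a m)) (cong (_+ length s) (length-block a m))))
    a+n≡ : a + n ≡ a + suc m + length s
    a+n≡ = trans (cong (a +_) n≡) (sym (+-assoc a (suc m) (length s)))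
    bounded′ : ∀ {v} → v ∈ s → a + suc m < v × v ≤ a + suc m + length s
    bounded′ {v} v∈s = subst (_< v) (sym K≡) K<v , subst (v ≤_) a+n≡ (proj₂ (bounded v∈π))
      where
      v∈π = there (∈-++⁺ʳ (block a m) v∈s)
      K<v : suc (a + m) < v
      K<v with v ≤? a + m
      ... | yes v≤a+m = ⊥-elim (unique-++-disjoint (block a m) (tail uniq) (∈-block⁺ a m (proj₁ (bounded v∈π)) v≤a+m) v∈s)
      ... | no  v≰a+m = ≤∧≢⇒< (≰⇒> v≰a+m) (λ { refl → Unique[x∷xs]⇒x∉xs uniq (∈-++⁺ʳ (block a m) v∈s) })
    covers′ : ∀ {v} → a + suc m < v → v ≤ a + suc m + length s → v ∈ s
    covers′ {v} K<v v≤ with covers (≤-<-trans (m≤m+n a (suc m)) K<v) (subst (v ≤_) (sym a+n≡) v≤)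
    ... | here refl = ⊥-elim (<-irrefl K≡ K<v)
    ... | there v∈ with ∈-++⁻ (block a m) v∈
    ...   | inj₁ v∈block = ⊥-elim (<⇒≱ K<v (≤-trans (proj₂ (∈-block⁻ a m v∈block)) (+-monoʳ-≤ a (n≤1+n m))))
    ...   | inj₂ v∈s     = v∈s

  avoider-layered : ∀ a {n π} → Arrangement a n π → Avoids π → ∃ λ c → IsComposition n c × layered a c ≡ π
  avoider-layered a {n} {π} = <-rec Goal step n a π
    where
    Goal : ℕ → Set
    Goal n = ∀ a π → Arrangement a n π → Avoids π → ∃ λ c → IsComposition n c × layered a c ≡ π
    step : ∀ n → (∀ {n′} → n′ < n → Goal n′) → Goal n
    step n rec a []      arr avoids = [] , subst (λ n → IsComposition n []) (Arrangement.length≡ arr) [] , refl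
    step n rec a (K ∷ t) arr avoids with m≤n⇒∃[o]m+o≡n (proj₁ (Arrangement.bounded arr (here refl)))
    ... | m , refl with avoider-begins-with-block (arrangement-unique arr) avoids (first-entry-covers arr)
    ... | s , refl with arrangement-after-block arr
    ... | n≡ , arr′ with rec (subst (length s <_) (sym n≡) (s≤s (m≤n+m (length s) m))) (a + suc m) s arr′
                            (λ w⊆s → avoids (_ ∷ʳ ++⁺ˡ (block a m) w⊆s))
    ... | c , comp , refl = suc m ∷ c , subst (λ n → IsComposition n (suc m ∷ c)) (sym n≡) (m ∷ comp) , refl

module Encoding where

  open LayeredPermutations
  open import Data.Bool using (true; false; T; not; if_then_else_)
  open import Data.Bool.Properties using (T-∧)
  open import Data.Unit using (tt)
  open import Data.Nat using (ℕ; zero; suc; _<_; _≤_; _<ᵇ_; z<s)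
  open import Data.Nat.Properties using (≤-refl; <⇒≤; <-trans; <ᵇ⇒<; ≡ᵇ⇒≡; ≡⇒≡ᵇ; suc-injective)
  open import Data.List using (List; []; _∷_; map; _++_; length; concatMap; cartesianProductWith)
  open import Data.List.Properties using (∷-injective)
  open import Data.List.Membership.Propositional using (find; lose)
  open import Data.List.Membership.Propositional.Properties
    using (∈-++⁻; ∈-++⁺ˡ; ∈-++⁺ʳ; ∈-map⁺; ∈-map⁻; ∈-upTo⁺; ∈-upTo⁻; ∈-filter⁺; ∈-filter⁻;
           ∈-cartesianProductWith⁺; ∈-cartesianProductWith⁻)
  open import Data.List.Relation.Unary.All as All using (All; []; _∷_)
  open import Data.List.Relation.Unary.All.Properties using (all⁺; all⁻)
  open import Data.List.Relation.Unary.Any.Properties using (any⁺; any⁻)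
  open import Data.List.Relation.Unary.AllPairs using ([]; _∷_)
  import Data.List.Relation.Unary.Unique.Propositional.Properties as Unique
  open import Data.List.Relation.Binary.Sublist.Propositional using (_⊆_; _∷_; _∷ʳ_; minimum)
  open import Data.List.Relation.Binary.Pointwise using (Pointwise; []; _∷_)
  open import Function using (Equivalence)

  ∈-range1⁻ : ∀ n {v} → v ∈ range1 n → 0 < v × v ≤ n
  ∈-range1⁻ n v∈ with ∈-map⁻ suc v∈
  ... | i , i∈ , refl = z<s , ∈-upTo⁻ i∈

  ∈-range1⁺ : ∀ n {v} → 0 < v → v ≤ n → v ∈ range1 n
  ∈-range1⁺ n {suc v} _ v<n = ∈-map⁺ suc (∈-upTo⁺ v<n)

  range1-unique : ∀ n → Unique (range1 n)
  range1-unique n = Unique.map⁺ suc-injective (Unique.upTo⁺ n)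

  words-suc : ∀ k n → words (suc k) n ≡ cartesianProductWith _∷_ (range1 n) (words k n)
  words-suc k n = go (range1 n)
    where
    go : ∀ vs → concatMap (λ v → map (v ∷_) (words k n)) vs ≡ cartesianProductWith _∷_ vs (words k n)
    go []       = refl
    go (v ∷ vs) = cong (map (v ∷_) (words k n) ++_) (go vs)

  ∈-words⁻ : ∀ k n {w} → w ∈ words k n → length w ≡ k × All (_∈ range1 n) w
  ∈-words⁻ zero    n (here refl) = refl , []
  ∈-words⁻ (suc k) n w∈ with ∈-cartesianProductWith⁻ _∷_ (range1 n) (words k n) (subst (_ ∈_) (words-suc k n) w∈)
  ... | v , w′ , v∈ , w′∈ , refl = let len , all = ∈-words⁻ k n w′∈ in cong suc len , v∈ ∷ all

  ∈-words⁺ : ∀ k n {w} → length w ≡ k → All (_∈ range1 n) w → w ∈ words k n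
  ∈-words⁺ zero    n {[]}    refl []         = here refl
  ∈-words⁺ (suc k) n {v ∷ w} len  (v∈ ∷ all) =
    subst (_ ∈_) (sym (words-suc k n)) (∈-cartesianProductWith⁺ _∷_ v∈ (∈-words⁺ k n (suc-injective len) all))

  words-unique : ∀ k n → Unique (words k n)
  words-unique zero    n = [] ∷ []
  words-unique (suc k) n = subst Unique (sym (words-suc k n))
    (Unique.cartesianProductWith⁺ _∷_ ∷-injective (range1-unique n) (words-unique k n))

  isPerm⁻ : ∀ n {w} → T (isPerm n w) → ∀ {v} → v ∈ range1 n → v ∈ w
  isPerm⁻ n {w} h v∈ with find (any⁻ _ w (All.lookup (all⁺ _ (range1 n) h) v∈))
  ... | u , u∈ , u≡ᵇv = subst (_∈ w) (≡ᵇ⇒≡ u _ u≡ᵇv) u∈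

  isPerm⁺ : ∀ n {w} → (∀ {v} → v ∈ range1 n → v ∈ w) → T (isPerm n w)
  isPerm⁺ n covers = all⁻ _ (All.tabulate (λ {v} v∈ → any⁺ _ (lose (covers v∈) (≡⇒≡ᵇ v v refl))))

  ∈-perms⁻ : ∀ n {π} → π ∈ perms n → Arrangement 0 n π
  ∈-perms⁻ n π∈ with ∈-filter⁻ _ π∈
  ... | π∈words , h with ∈-words⁻ n n π∈words
  ...   | len , entries = record
    { length≡ = len
    ; bounded = λ v∈ → ∈-range1⁻ n (All.lookup entries v∈)
    ; covers  = λ 0<v v≤n → isPerm⁻ n h (∈-range1⁺ n 0<v v≤n)
    }

  ∈-perms⁺ : ∀ n {π} → Arrangement 0 n π → π ∈ perms n
  ∈-perms⁺ n arr = ∈-filter⁺ _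
    (∈-words⁺ n n length≡ (All.tabulate λ v∈ → let 0<v , v≤n = bounded v∈ in ∈-range1⁺ n 0<v v≤n))
    (isPerm⁺ n λ v∈ → let 0<v , v≤n = ∈-range1⁻ n v∈ in covers 0<v v≤n)
    where open Arrangement arr

  perms-unique : ∀ n → Unique (perms n)
  perms-unique n = Unique.filter⁺ _ (words-unique n n)

  ∈-subseqs⁺ : ∀ {w π} → w ⊆ π → w ∈ subseqs (length w) π
  ∈-subseqs⁺ {[]}        _          = here refl
  ∈-subseqs⁺ {x ∷ w} {y ∷ π} (_ ∷ʳ s)   = ∈-++⁺ʳ (map (y ∷_) (subseqs (length w) π)) (∈-subseqs⁺ s)
  ∈-subseqs⁺ {x ∷ w}         (refl ∷ s) = ∈-++⁺ˡ (∈-map⁺ (x ∷_) (∈-subseqs⁺ s))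

  ∈-subseqs⁻ : ∀ k π {w} → w ∈ subseqs k π → w ⊆ π × length w ≡ k
  ∈-subseqs⁻ zero    π        (here refl) = minimum π , refl
  ∈-subseqs⁻ (suc k) (x ∷ π) w∈ with ∈-++⁻ (map (x ∷_) (subseqs k π)) w∈
  ... | inj₁ w∈kept with ∈-map⁻ (x ∷_) w∈kept
  ...   | w′ , w′∈ , refl = let s , len = ∈-subseqs⁻ k π w′∈ in refl ∷ s , cong suc len
  ∈-subseqs⁻ (suc k) (x ∷ π) w∈ | inj₂ w∈skipped = let s , len = ∈-subseqs⁻ (suc k) π w∈skipped in x ∷ʳ s , len

  eqBools⇒Pointwise : ∀ as bs → T (eqBools as bs) → Pointwise _≡_ as bs
  eqBools⇒Pointwise []       []       _ = []
  eqBools⇒Pointwise (a ∷ as) (b ∷ bs) h with Equivalence.to T-∧ h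
  ... | same , rest = agree a b same ∷ eqBools⇒Pointwise as bs rest
    where
    agree : ∀ a b → T (if a then b else not b) → a ≡ b
    agree true  true  _ = refl
    agree false false _ = refl

  <ᵇ-holds : ∀ {m n} → true ≡ (m <ᵇ n) → m < n
  <ᵇ-holds {m} {n} eq = <ᵇ⇒< m n (subst T eq tt)

  sameOrder-231⁻ : ∀ {x y z} → T (sameOrder (2 ∷ 3 ∷ 1 ∷ []) (x ∷ y ∷ z ∷ [])) → z < x × x < y
  sameOrder-231⁻ {x} {y} {z} h with eqBools⇒Pointwise (relOrder (2 ∷ 3 ∷ 1 ∷ [])) (relOrder (x ∷ y ∷ z ∷ [])) h
  ... | _ ∷ x<y ∷ _ ∷ _ ∷ _ ∷ _ ∷ z<x ∷ _ ∷ _ ∷ [] = <ᵇ-holds z<x , <ᵇ-holds x<y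

  sameOrder-312⁻ : ∀ {x y z} → T (sameOrder (3 ∷ 1 ∷ 2 ∷ []) (x ∷ y ∷ z ∷ [])) → y < z × z < x
  sameOrder-312⁻ {x} {y} {z} h with eqBools⇒Pointwise (relOrder (3 ∷ 1 ∷ 2 ∷ [])) (relOrder (x ∷ y ∷ z ∷ [])) h
  ... | _ ∷ _ ∷ _ ∷ _ ∷ _ ∷ y<z ∷ z<x ∷ _ ∷ _ ∷ [] = <ᵇ-holds y<z , <ᵇ-holds z<x

  sameOrder-231⁺ : ∀ {x y z} → z < x → x < y → T (sameOrder (2 ∷ 3 ∷ 1 ∷ []) (x ∷ y ∷ z ∷ []))
  sameOrder-231⁺ {x} {y} {z} z<x x<y
    rewrite <ᵇ-false (≤-refl {x}) | <ᵇ-false (≤-refl {y}) | <ᵇ-false (≤-refl {z})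
          | <ᵇ-true x<y | <ᵇ-true z<x | <ᵇ-true (<-trans z<x x<y)
          | <ᵇ-false (<⇒≤ x<y) | <ᵇ-false (<⇒≤ z<x) | <ᵇ-false (<⇒≤ (<-trans z<x x<y)) = tt

  sameOrder-312⁺ : ∀ {x y z} → y < z → z < x → T (sameOrder (3 ∷ 1 ∷ 2 ∷ []) (x ∷ y ∷ z ∷ []))
  sameOrder-312⁺ {x} {y} {z} y<z z<x
    rewrite <ᵇ-false (≤-refl {x}) | <ᵇ-false (≤-refl {y}) | <ᵇ-false (≤-refl {z})
          | <ᵇ-true y<z | <ᵇ-true z<x | <ᵇ-true (<-trans y<z z<x)
          | <ᵇ-false (<⇒≤ y<z) | <ᵇ-false (<⇒≤ z<x) | <ᵇ-false (<⇒≤ (<-trans y<z z<x)) = tt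

  forbidden-patterns : List (List ℕ)
  forbidden-patterns = (2 ∷ 3 ∷ 1 ∷ []) ∷ (3 ∷ 1 ∷ 2 ∷ []) ∷ []

  occurrence : ∀ σ π → T (contains π σ) → ∃ λ w → w ⊆ π × length w ≡ length σ × T (sameOrder σ w)
  occurrence σ π h with find (any⁻ _ _ h)
  ... | w , w∈ , same = let s , len = ∈-subseqs⁻ (length σ) π w∈ in w , s , len , same

  avoidsAll⁻ : ∀ π → T (avoidsAll forbidden-patterns π) →
               ¬ T (contains π (2 ∷ 3 ∷ 1 ∷ [])) × ¬ T (contains π (3 ∷ 1 ∷ 2 ∷ []))
  avoidsAll⁻ π h with contains π (2 ∷ 3 ∷ 1 ∷ []) | contains π (3 ∷ 1 ∷ 2 ∷ [])
  avoidsAll⁻ π () | true  | _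
  avoidsAll⁻ π () | false | true
  avoidsAll⁻ π h  | false | false = (λ ()) , (λ ())

  avoidsAll⁺ : ∀ π → ¬ T (contains π (2 ∷ 3 ∷ 1 ∷ [])) → ¬ T (contains π (3 ∷ 1 ∷ 2 ∷ [])) →
               T (avoidsAll forbidden-patterns π)
  avoidsAll⁺ π no231 no312 with contains π (2 ∷ 3 ∷ 1 ∷ []) | contains π (3 ∷ 1 ∷ 2 ∷ [])
  ... | true  | _     = ⊥-elim (no231 tt)
  ... | false | true  = ⊥-elim (no312 tt)
  ... | false | false = tt

  avoidsAll⇒Avoids : ∀ π → T (avoidsAll forbidden-patterns π) → Avoids π
  avoidsAll⇒Avoids π h s (inj₁ (z<x , x<y)) =
    proj₁ (avoidsAll⁻ π h) (any⁺ _ (lose (∈-subseqs⁺ s) (sameOrder-231⁺ z<x x<y)))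
  avoidsAll⇒Avoids π h s (inj₂ (y<z , z<x)) =
    proj₂ (avoidsAll⁻ π h) (any⁺ _ (lose (∈-subseqs⁺ s) (sameOrder-312⁺ y<z z<x)))

  Avoids⇒avoidsAll : ∀ π → Avoids π → T (avoidsAll forbidden-patterns π)
  Avoids⇒avoidsAll π avoids = avoidsAll⁺ π no231 no312
    where
    no231 : ¬ T (contains π (2 ∷ 3 ∷ 1 ∷ []))
    no231 h with occurrence (2 ∷ 3 ∷ 1 ∷ []) π h
    ... | x ∷ y ∷ z ∷ [] , s , refl , same = avoids s (inj₁ (sameOrder-231⁻ same))
    no312 : ¬ T (contains π (3 ∷ 1 ∷ 2 ∷ []))
    no312 h with occurrence (3 ∷ 1 ∷ 2 ∷ []) π h
    ... | x ∷ y ∷ z ∷ [] , s , refl , same = avoids s (inj₂ (sameOrder-312⁻ same))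

open ListFacts
open PowerSeries using (⊛-congˡ)
open Compositions
open CompositionSeries using (compositionSeries; compositionSeries-⊛-denom)
open LayeredPermutations
open AvoidersAreLayered
open Encoding
open import Data.Bool using (Bool; T; _∧_)
open import Data.Bool.Properties using (T-≡; T-∧)
open import Data.Nat using (ℕ; _≡ᵇ_)
open import Data.Integer using (+_)
open import Data.List using (map; filter; length)
open import Data.List.Membership.Propositional.Properties using (∈-map⁺; ∈-map⁻)
import Data.List.Relation.Unary.All as All
open import Function using (_∘_; Equivalence)
open import Relation.Unary using (Decidable)

selects : ℕ → ℕ → List ℕ → Bool
selects i j π = avoidsAll forbidden-patterns π ∧ (fp π ≡ᵇ i) ∧ (exc π ≡ᵇ j)

layered-selects : ∀ i j {n c} → IsComposition n c → selects i j (layered 0 c) ≡ hasStats i j c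
layered-selects i j {c = c} comp
  rewrite Equivalence.to T-≡ (Avoids⇒avoidsAll (layered 0 c) (layered-avoids 0 comp))
        | layered-fp 0 c | layered-exc 0 c = refl

layered-permutations : ℕ → List (List ℕ)
layered-permutations n = map (layered 0) (compositions n)

-- P? is arbitrary because the decision procedure used by F is local to its definition.
count-selected-perms : ∀ i j n (P? : Decidable (T ∘ selects i j)) →
                       length (filter P? (perms n)) ≡ count (hasStats i j) (compositions n)
count-selected-perms i j n P? = begin
  length (filter P? (perms n))
    ≡⟨ length-filter-unique P? (perms-unique n) unique avoider∈ layered∈ ⟩
  length (filter P? (layered-permutations n))
    ≡⟨ length-filter≡count (selects i j) P? (layered-permutations n) ⟩
  count (selects i j) (layered-permutations n)
    ≡⟨ count-map (selects i j) (layered 0) (compositions n) ⟩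
  count (selects i j ∘ layered 0) (compositions n)
    ≡⟨ count-cong (compositions n) (λ c∈ → layered-selects i j (sound c∈)) ⟩
  count (hasStats i j) (compositions n) ∎
  where
  open ≡-Reasoning
  sound : ∀ {c} → c ∈ compositions n → IsComposition n c
  sound = All.lookup (compositions-sound n)
  unique : Unique (layered-permutations n)
  unique = unique-map⁺ (layered 0) (λ x∈ y∈ → layered-injective 0 (sound x∈) (sound y∈)) (compositions-unique n)
  avoider∈ : ∀ {π} → T (selects i j π) → π ∈ perms n → π ∈ layered-permutations n
  avoider∈ {π} sel π∈ with avoider-layered 0 (∈-perms⁻ n π∈) (avoidsAll⇒Avoids π (proj₁ (Equivalence.to T-∧ sel)))
  ... | c , comp , refl = ∈-map⁺ (layered 0) (compositions-complete comp)
  layered∈ : ∀ {π} → T (selects i j π) → π ∈ layered-permutations n → π ∈ perms n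
  layered∈ _ π∈ with ∈-map⁻ (layered 0) π∈
  ... | c , c∈ , refl = ∈-perms⁺ n (layered-arrangement 0 (sound c∈))

F≡compositionSeries : ∀ i j n → F forbidden-patterns i j n ≡ compositionSeries i j n
F≡compositionSeries i j n = cong +_ (count-selected-perms i j n _)

proposition4p7 : ∀ i j n →
    (F ((2 ∷ 3 ∷ 1 ∷ []) ∷ (3 ∷ 1 ∷ 2 ∷ []) ∷ []) ⊛ denom) i j n ≡ numer i j n
proposition4p7 i j n = trans (⊛-congˡ denom F≡compositionSeries i j n) (compositionSeries-⊛-denom i j n)
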